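{- Let $k\geq 2$ and let $A_1,\dots,A_k$ be finite, nonempty sets of integers. For each $i$ let $A_i'$ be the set consisting of the smallest and the largest element of $A_i$ (a two-element set, or a one-element set if $|A_i|=1$). Put \[ S=A_1+\dots+A_k,\qquad S_i=A_1+\dots+A_{i-1}+A_{i+1}+\dots+A_k,\] \[ S_i'=A_1+\dots+A_{i-1}+A_i'+A_{i+1}+\dots+A_k,\qquad S'=\bigcup_{i=1}^k S_i'. \] Then \[ |S|\geq |S'|\geq \frac{1}{k-1}\sum_{i=1}^k |S_i| - \frac{1}{k-1}. \]
   Context: For sets $X,Y$ of integers, $X+Y=\{x+y: x\in X, y\in Y\}$; iterated sums are defined analogously. -}

module Defs where

open import Data.Nat using (ℕ)
open import Data.Integer using (ℤ; _+_; _⊓_; _⊔_) renaming (_≟_ to _≟ℤ_)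
open import Data.Fin using (Fin) renaming (_≟_ to _≟F_)
open import Data.List using (List; []; _∷_; map; concatMap; length; deduplicate; filter; allFin; foldr)
open import Data.Bool using (if_then_else_)
open import Relation.Nullary using (¬?)
open import Relation.Nullary.Decidable using (⌊_⌋)

-- Finite sets of integers are represented by lists; repetitions are allowed
-- and ignored by the cardinality function.

card : List ℤ → ℕ
card xs = length (deduplicate _≟ℤ_ xs)

_⊕_ : List ℤ → List ℤ → List ℤ
X ⊕ Y = concatMap (λ x → map (λ y → x + y) Y) X

sumsetL : List (List ℤ) → List ℤ
sumsetL = foldr _⊕_ (ℤ.pos 0 ∷ [])

-- smallest / largest element of a nonempty list (value on [] is irrelevant)
minL : List ℤ → ℤ
minL [] = ℤ.pos 0
minL (x ∷ xs) = foldr _⊓_ x xs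

maxL : List ℤ → ℤ
maxL [] = ℤ.pos 0
maxL (x ∷ xs) = foldr _⊔_ x xs

ends : List ℤ → List ℤ
ends X = minL X ∷ maxL X ∷ []

module _ {k : ℕ} (A : Fin k → List ℤ) where
  S : List ℤ
  S = sumsetL (map A (allFin k))

  Sᵢ : Fin k → List ℤ
  Sᵢ i = sumsetL (map A (filter (λ j → ¬? (j ≟F i)) (allFin k)))

  S'ᵢ : Fin k → List ℤ
  S'ᵢ i = sumsetL (map (λ j → if ⌊ j ≟F i ⌋ then ends (A j) else A j) (allFin k))

  S' : List ℤ
  S' = concatMap S'ᵢ (allFin k)

module Submission where

-- Write mᵢ, Mᵢ for the least and largest element of Aᵢ, m = Σ mᵢ and M = Σ Mᵢ, so that
-- S' ⊆ S ⊆ [m, M].  Cut [m, M) into consecutive gaps Gᵢ of length Mᵢ − mᵢ.  Sending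
-- x ∈ Sᵢ to x + mᵢ if that lies below Gᵢ, and to x + Mᵢ otherwise, is an injection
-- Sᵢ → S'ᵢ ∖ Gᵢ, so |Sᵢ| ≤ |S' ∖ Gᵢ|.  Summing over i, every u ∈ S' is counted once for
-- each gap missing it: at most k − 1 times when u < M, because the gaps cover [m, M),
-- and at most k times for the single element u = M.

open import Defs
open import Data.Nat using (ℕ; _≤_; _*_; _+_; _∸_)
open import Data.Integer using (ℤ)
open import Data.Fin using (Fin)
open import Data.List using (List; []; map; allFin)
open import Data.Nat.ListAction using (sum)
open import Data.Product using (_×_)
open import Relation.Binary.PropositionalEquality using (_≢_)

open import Data.Nat as ℕ using (suc; z≤n; _<_)
import Data.Nat.Properties as ℕ
open import Data.Integer as ℤ using (0ℤ; _-_; _<?_)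
import Data.Integer.Properties as ℤ
open import Data.Integer.Tactic.RingSolver using (solve-∀)
open import Algebra.Properties.CommutativeSemigroup ℕ.+-commutativeSemigroup
  using () renaming (x∙yz≈y∙xz to +-exchange)
open import Algebra.Properties.AbelianGroup ℤ.+-0-abelianGroup
  using () renaming (∙-cancelʳ to +-cancelʳ)
open import Data.Fin as Fin using (zero; suc)
open import Data.Fin.Properties using (injective⇒≤)
open import Data.List using (_∷_; filter; length; lookup; foldr; tabulate; deduplicate)
open import Data.List.Properties
  using ( filter-all; length-filter; filter-notAll; length-map; map-tabulate; length-tabulate
        ; foldr-preservesᵒ)
open import Data.List.Membership.Propositional using (_∈_; lose; find)
open import Data.List.Membership.Propositional.Properties
open import Data.List.Membership.Setoid.Properties using (index-injective)
open import Data.List.Relation.Unary.Any as Any using (here; there)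
import Data.List.Relation.Unary.All as All
open import Data.List.Relation.Unary.AllPairs using (_∷_)
open import Data.List.Relation.Unary.Unique.Propositional using (Unique)
import Data.List.Relation.Unary.Unique.Propositional.Properties as Unique
import Data.List.Relation.Unary.Unique.DecPropositional.Properties as UniqueDec
open import Data.List.Relation.Binary.Subset.Propositional using (_⊆_)
open import Data.Product using (_,_; ∃; ∃₂; proj₂)
open import Data.Sum using (_⊎_; inj₁; inj₂; [_,_]; [_,_]′)
open import Data.Bool using (if_then_else_)
open import Function using (_∘_)
open import Relation.Nullary using (¬_; ¬?; yes; no; does; Dec; contradiction)
open import Relation.Nullary.Decidable using (⌊_⌋; _×-dec_)
open import Relation.Unary using (Decidable)
open import Relation.Binary.Definitions using (DecidableEquality)
open import Relation.Binary.PropositionalEquality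
  using (_≡_; refl; sym; trans; cong; subst; setoid; module ≡-Reasoning)

private
  variable
    E I : Set
    X Y X' Y' : List ℤ
    x y z : ℤ

∈-⊕⁺ : x ∈ X → y ∈ Y → x ℤ.+ y ∈ X ⊕ Y
∈-⊕⁺ {x} {Y = Y} x∈X y∈Y =
  ∈-concatMap⁺ (λ x → map (λ y → x ℤ.+ y) Y) (lose x∈X (∈-map⁺ (λ y → x ℤ.+ y) y∈Y))

∈-⊕⁻ : ∀ X Y → z ∈ X ⊕ Y → ∃₂ λ x y → x ∈ X × y ∈ Y × z ≡ x ℤ.+ y
∈-⊕⁻ X Y z∈X⊕Y with find (∈-concatMap⁻ (λ x → map (λ y → x ℤ.+ y) Y) {xs = X} z∈X⊕Y)
... | x , x∈X , z∈x+Y with ∈-map⁻ (λ y → x ℤ.+ y) z∈x+Y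
... | y , y∈Y , z≡x+y = x , y , x∈X , y∈Y , z≡x+y

⊕-mono : X ⊆ X' → Y ⊆ Y' → X ⊕ Y ⊆ X' ⊕ Y'
⊕-mono {X} {Y = Y} X⊆X' Y⊆Y' z∈X⊕Y with ∈-⊕⁻ X Y z∈X⊕Y
... | x , y , x∈X , y∈Y , refl = ∈-⊕⁺ (X⊆X' x∈X) (Y⊆Y' y∈Y)

sumsetL-mono : (F G : I → List ℤ) (L : List I) → (∀ {j} → j ∈ L → F j ⊆ G j) →
  sumsetL (map F L) ⊆ sumsetL (map G L)
sumsetL-mono F G []      F⊆G = λ z∈ → z∈
sumsetL-mono F G (j ∷ L) F⊆G = ⊕-mono (F⊆G (here refl)) (sumsetL-mono F G L (F⊆G ∘ there))

module _ (_≟_ : DecidableEquality I) (F : I → List ℤ) where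

  sumsetL-insert : ∀ {L i x a} → Unique L → i ∈ L →
    x ∈ sumsetL (map F (filter (λ j → ¬? (j ≟ i)) L)) → a ∈ F i →
    x ℤ.+ a ∈ sumsetL (map F L)
  sumsetL-insert {j ∷ L} {i} {x} {a} (i∉L ∷ _) _ x∈ a∈Fi with j ≟ i
  ... | yes refl = subst (_∈ sumsetL (map F (j ∷ L))) (ℤ.+-comm a x)
    (∈-⊕⁺ a∈Fi (subst (λ L′ → x ∈ sumsetL (map F L′))
                      (filter-all _ (All.map (_∘ sym) i∉L)) x∈))
  sumsetL-insert {j ∷ L} {i} {a = a} (_ ∷ uniqueL) i∈j∷L x∈ a∈Fi | no j≢i
    with ∈-⊕⁻ (F j) _ x∈ | i∈j∷L
  ... | _ , _ , _ , _ , _ | here i≡j = contradiction (sym i≡j) j≢i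
  ... | y , w , y∈Fj , w∈ , refl | there i∈L =
    subst (_∈ sumsetL (map F (j ∷ L))) (sym (ℤ.+-assoc y w a))
      (∈-⊕⁺ y∈Fj (sumsetL-insert uniqueL i∈L w∈ a∈Fi))

minL-≤ : x ∈ X → minL X ℤ.≤ x
minL-≤ {X = a ∷ X} x∈X = foldr-preservesᵒ
  (λ y z → [ ℤ.≤-trans (ℤ.i⊓j≤i y z) , ℤ.≤-trans (ℤ.i⊓j≤j y z) ])
  a X (Any.toSum (lose x∈X ℤ.≤-refl))

≤-maxL : x ∈ X → x ℤ.≤ maxL X
≤-maxL {X = a ∷ X} x∈X = foldr-preservesᵒ
  (λ y z → [ (λ x≤y → ℤ.≤-trans x≤y (ℤ.i≤i⊔j y z))
            , (λ x≤z → ℤ.≤-trans x≤z (ℤ.i≤j⊔i y z)) ])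
  a X (Any.toSum (lose x∈X ℤ.≤-refl))

minL-∈ : X ≢ [] → minL X ∈ X
minL-∈ {[]}    X≢[] = contradiction refl X≢[]
minL-∈ {a ∷ X} _    = [ here , there ]′ (foldr-selective ℤ.⊓-sel a X)

maxL-∈ : X ≢ [] → maxL X ∈ X
maxL-∈ {[]}    X≢[] = contradiction refl X≢[]
maxL-∈ {a ∷ X} _    = [ here , there ]′ (foldr-selective ℤ.⊔-sel a X)

minL≤maxL : X ≢ [] → minL X ℤ.≤ maxL X
minL≤maxL X≢[] = ℤ.≤-trans (minL-≤ (minL-∈ X≢[])) (≤-maxL (minL-∈ X≢[]))

ends-⊆ : X ≢ [] → ends X ⊆ X
ends-⊆ X≢[] (here refl)         = minL-∈ X≢[]
ends-⊆ X≢[] (there (here refl)) = maxL-∈ X≢[]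

sumℤ : List ℤ → ℤ
sumℤ = foldr ℤ._+_ 0ℤ

sumsetL-bounds : (F : I → List ℤ) (L : List I) → z ∈ sumsetL (map F L) →
  sumℤ (map (minL ∘ F) L) ℤ.≤ z × z ℤ.≤ sumℤ (map (maxL ∘ F) L)
sumsetL-bounds F []      (here refl) = ℤ.≤-refl , ℤ.≤-refl
sumsetL-bounds F (j ∷ L) z∈ with ∈-⊕⁻ (F j) _ z∈
... | x , y , x∈Fj , y∈ , refl with sumsetL-bounds F L y∈
... | lo , hi = ℤ.+-mono-≤ (minL-≤ x∈Fj) lo , ℤ.+-mono-≤ (≤-maxL x∈Fj) hi

sumℤ-map-+-differences : (f g : I → ℤ) (L : List I) →
  sumℤ (map f L) ℤ.+ sumℤ (map (λ i → g i - f i) L) ≡ sumℤ (map g L)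
sumℤ-map-+-differences f g []      = refl
sumℤ-map-+-differences f g (i ∷ L) =
  trans (regroup (f i) (g i) (sumℤ (map f L)) _) (cong (ℤ._+_ (g i)) (sumℤ-map-+-differences f g L))
  where
    regroup : ∀ a b r s → a ℤ.+ r ℤ.+ (b - a ℤ.+ s) ≡ b ℤ.+ (r ℤ.+ s)
    regroup = solve-∀

lookup-injective : ∀ {xs : List E} → Unique xs → ∀ {i j} → lookup xs i ≡ lookup xs j → i ≡ j
lookup-injective {xs = x ∷ xs} (_ ∷ _)        {zero}  {zero}  _  = refl
lookup-injective {xs = x ∷ xs} (x∉xs ∷ _)     {zero}  {suc j} eq =
  contradiction eq (All.lookup x∉xs (∈-lookup j))
lookup-injective {xs = x ∷ xs} (x∉xs ∷ _)     {suc i} {zero}  eq =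
  contradiction (sym eq) (All.lookup x∉xs (∈-lookup i))
lookup-injective {xs = x ∷ xs} (_ ∷ uniqueXs) {suc i} {suc j} eq =
  cong suc (lookup-injective uniqueXs eq)

Unique-length-≤ : ∀ {xs ys : List E} → Unique xs → xs ⊆ ys → length xs ≤ length ys
Unique-length-≤ uniqueXs xs⊆ys = injective⇒≤ λ eq →
  lookup-injective uniqueXs (index-injective (setoid _) (xs⊆ys (∈-lookup _)) (xs⊆ys (∈-lookup _)) eq)

card-mono : X ⊆ Y → card X ≤ card Y
card-mono {X} X⊆Y = Unique-length-≤ (UniqueDec.deduplicate-! ℤ._≟_ X)
  (∈-deduplicate⁺ ℤ._≟_ ∘ X⊆Y ∘ ∈-deduplicate⁻ ℤ._≟_ X)

card-≤-filter-image : {P : ℤ → Set} (P? : Decidable P) (g : ℤ → ℤ) →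
  (∀ {x y} → g x ≡ g y → x ≡ y) →
  (∀ {x} → x ∈ X → g x ∈ Y) → (∀ x → P (g x)) →
  card X ≤ length (filter P? (deduplicate ℤ._≟_ Y))
card-≤-filter-image {X} {Y} P? g g-injective g[X]⊆Y P[g] =
  subst (_≤ _) (length-map g dedupX)
    (Unique-length-≤ (Unique.map⁺ g-injective (UniqueDec.deduplicate-! ℤ._≟_ X)) g[dedupX]⊆)
  where
    dedupX : List ℤ
    dedupX = deduplicate ℤ._≟_ X
    g[dedupX]⊆ : map g dedupX ⊆ filter P? (deduplicate ℤ._≟_ Y)
    g[dedupX]⊆ gx∈ with ∈-map⁻ g gx∈
    ... | x , x∈ , refl =
      ∈-filter⁺ P? (∈-deduplicate⁺ ℤ._≟_ (g[X]⊆Y (∈-deduplicate⁻ ℤ._≟_ X x∈))) (P[g] x)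

module _ {P : I → E → Set} (P? : ∀ a u → Dec (P a u)) where

  #row : I → List E → ℕ
  #row a U = length (filter (P? a) U)

  #column : List I → E → ℕ
  #column L u = length (filter (λ a → P? a u) L)

  sum-#row-∷ : ∀ L u U →
    sum (map (λ a → #row a (u ∷ U)) L) ≡ #column L u + sum (map (λ a → #row a U) L)
  sum-#row-∷ []      u U = refl
  sum-#row-∷ (a ∷ L) u U rewrite sum-#row-∷ L u U with P? a u
  ... | yes _ = cong suc (+-exchange (#row a U) (#column L u) _)
  ... | no  _ = +-exchange (#row a U) (#column L u) _

  sum-#row≡sum-#column : ∀ L U → sum (map (λ a → #row a U) L) ≡ sum (map (#column L) U)
  sum-#row≡sum-#column L []      = sum-map-zero L
    where
      sum-map-zero : ∀ L → sum (map (λ _ → 0) L) ≡ 0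
      sum-map-zero []      = refl
      sum-map-zero (_ ∷ L) = sum-map-zero L
  sum-#row≡sum-#column L (u ∷ U) = trans (sum-#row-∷ L u U) (cong (_ +_) (sum-#row≡sum-#column L U))

sum-map-mono : {f g : E → ℕ} → (∀ u → f u ≤ g u) → ∀ U → sum (map f U) ≤ sum (map g U)
sum-map-mono f≤g []      = z≤n
sum-map-mono f≤g (u ∷ U) = ℕ.+-mono-≤ (f≤g u) (sum-map-mono f≤g U)

module _ (f : E → ℕ) (n : ℕ) where

  sum-map-≤ : ∀ {U} → (∀ {u} → u ∈ U → f u ≤ n) → sum (map f U) ≤ n * length U
  sum-map-≤ {[]}    _   = z≤n
  sum-map-≤ {u ∷ U} f≤n = ℕ.≤-trans (ℕ.+-mono-≤ (f≤n (here refl)) (sum-map-≤ (f≤n ∘ there)))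
    (ℕ.≤-reflexive (sym (ℕ.*-suc n (length U))))

  sum-map-≤-except : ∀ c {U} → Unique U →
    (∀ u → f u ≤ suc n) → (∀ {u} → u ∈ U → u ≢ c → f u ≤ n) →
    sum (map f U) ≤ n * length U + 1
  sum-map-≤-except c {[]}    _                f≤1+n f≤n = z≤n
  sum-map-≤-except c {u ∷ U} (u∉U ∷ uniqueU) f≤1+n f≤n with f u ℕ.≤? n
  ... | yes fu≤n = begin
    f u + sum (map f U)     ≤⟨ ℕ.+-mono-≤ fu≤n (sum-map-≤-except c uniqueU f≤1+n (f≤n ∘ there)) ⟩
    n + (n * length U + 1)  ≡⟨ ℕ.+-assoc n _ 1 ⟨
    n + n * length U + 1    ≡⟨ cong (_+ 1) (ℕ.*-suc n (length U)) ⟨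
    n * suc (length U) + 1  ∎
    where open ℕ.≤-Reasoning
  ... | no fu≰n = begin
    f u + sum (map f U)     ≤⟨ ℕ.+-mono-≤ (f≤1+n u) (sum-map-≤ (λ v∈U → f≤n (there v∈U) (v≢c v∈U))) ⟩
    suc n + n * length U    ≡⟨ ℕ.+-comm 1 (n + n * length U) ⟩
    n + n * length U + 1    ≡⟨ cong (_+ 1) (ℕ.*-suc n (length U)) ⟨
    n * suc (length U) + 1  ∎
    where
      open ℕ.≤-Reasoning
      -- f u ≰ n forces u = c (constructively: ¬ u ≢ c), and U, being free of u, avoids c.
      v≢c : ∀ {v} → v ∈ U → v ≢ c
      v≢c v∈U refl = fu≰n (f≤n (here refl) (All.lookup u∉U v∈U))

prefixSum : ∀ {k} → ℤ → (Fin k → ℤ) → Fin k → ℤ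
prefixSum c d zero    = c
prefixSum c d (suc i) = prefixSum (c ℤ.+ d zero) (d ∘ suc) i

prefixSum-cover : ∀ {k} c (d : Fin k → ℤ) {u} → c ℤ.≤ u → u ℤ.< c ℤ.+ sumℤ (tabulate d) →
  ∃ λ i → prefixSum c d i ℤ.≤ u × u ℤ.< prefixSum c d i ℤ.+ d i
prefixSum-cover {ℕ.zero}  c d c≤u u<c+0 =
  contradiction (subst (_ ℤ.<_) (ℤ.+-identityʳ c) u<c+0) (ℤ.≤⇒≯ c≤u)
prefixSum-cover {ℕ.suc k} c d {u} c≤u u<c+Σd with u <? c ℤ.+ d zero
... | yes u<c+d₀ = zero , c≤u , u<c+d₀
... | no  u≮c+d₀ with prefixSum-cover (c ℤ.+ d zero) (d ∘ suc) (ℤ.≮⇒≥ u≮c+d₀)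
                        (subst (u ℤ.<_) (sym (ℤ.+-assoc c (d zero) _)) u<c+Σd)
... | i , lo , hi = suc i , lo , hi

module Jump (a b t : ℤ) where

  jump : ℤ → ℤ
  jump x = if does (x ℤ.+ a <? t) then x ℤ.+ a else x ℤ.+ b

  jump-cases : ∀ x → jump x ≡ x ℤ.+ a ⊎ jump x ≡ x ℤ.+ b
  jump-cases x with x ℤ.+ a <? t
  ... | yes _ = inj₁ refl
  ... | no  _ = inj₂ refl

  jump-∉-gap : ∀ x → ¬ (t ℤ.≤ jump x × jump x ℤ.< t ℤ.+ (b - a))
  jump-∉-gap x (t≤jx , jx<t+b-a) with x ℤ.+ a <? t
  ... | yes x+a<t = ℤ.<⇒≱ x+a<t t≤jx
  ... | no  x+a≮t = ℤ.<⇒≱ jx<t+b-a (begin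
    t ℤ.+ (b - a)        ≤⟨ ℤ.+-monoˡ-≤ (b - a) (ℤ.≮⇒≥ x+a≮t) ⟩
    x ℤ.+ a ℤ.+ (b - a)  ≡⟨ +-difference x a b ⟩
    x ℤ.+ b              ∎)
    where
      open ℤ.≤-Reasoning
      +-difference : ∀ x a b → x ℤ.+ a ℤ.+ (b - a) ≡ x ℤ.+ b
      +-difference = solve-∀

  ≤-jump-right : a ℤ.≤ b → ∀ x → ¬ (x ℤ.+ a ℤ.< t) → t ℤ.≤ x ℤ.+ b
  ≤-jump-right a≤b x x+a≮t = ℤ.≤-trans (ℤ.≮⇒≥ x+a≮t) (ℤ.+-monoʳ-≤ x a≤b)

  jump-injective : a ℤ.≤ b → ∀ {x y} → jump x ≡ jump y → x ≡ y
  jump-injective a≤b {x} {y} jx≡jy with x ℤ.+ a <? t | y ℤ.+ a <? t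
  ... | yes _     | yes _     = +-cancelʳ a x y jx≡jy
  ... | no  _     | no  _     = +-cancelʳ b x y jx≡jy
  ... | yes x+a<t | no  y+a≮t =
    contradiction x+a<t (ℤ.≤⇒≯ (subst (t ℤ.≤_) (sym jx≡jy) (≤-jump-right a≤b y y+a≮t)))
  ... | no  x+a≮t | yes y+a<t =
    contradiction y+a<t (ℤ.≤⇒≯ (subst (t ℤ.≤_) jx≡jy (≤-jump-right a≤b x x+a≮t)))

module Gaps {k : ℕ} (A : Fin k → List ℤ) (A≢[] : ∀ i → A i ≢ []) where

  -- S'ᵢ A i is by definition the sumset of A′ i over allFin k.
  A′ : Fin k → Fin k → List ℤ
  A′ i j = if ⌊ j Fin.≟ i ⌋ then ends (A j) else A j

  A′-⊆ : ∀ i j → A′ i j ⊆ A j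
  A′-⊆ i j with j Fin.≟ i
  ... | yes _ = ends-⊆ (A≢[] j)
  ... | no  _ = λ x∈ → x∈

  A′-diag : ∀ i → A′ i i ≡ ends (A i)
  A′-diag i with i Fin.≟ i
  ... | yes _   = refl
  ... | no  i≢i = contradiction refl i≢i

  A′-off-diag : ∀ {i j} → j ≢ i → A′ i j ≡ A j
  A′-off-diag {i} {j} j≢i with j Fin.≟ i
  ... | yes j≡i = contradiction j≡i j≢i
  ... | no  _   = refl

  others : Fin k → List (Fin k)
  others i = filter (λ j → ¬? (j Fin.≟ i)) (allFin k)

  others-≢ : ∀ {i j} → j ∈ others i → j ≢ i
  others-≢ {i} = proj₂ ∘ ∈-filter⁻ (λ j → ¬? (j Fin.≟ i)) {xs = allFin k}

  S'⊆S : S' A ⊆ S A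
  S'⊆S u∈S' with find (∈-concatMap⁻ (S'ᵢ A) {xs = allFin k} u∈S')
  ... | i , _ , u∈S'ᵢ = sumsetL-mono (A′ i) A (allFin k) (λ {j} _ → A′-⊆ i j) u∈S'ᵢ

  m M : ℤ
  m = sumℤ (map (minL ∘ A) (allFin k))
  M = sumℤ (map (maxL ∘ A) (allFin k))

  S'-bounds : ∀ {u} → u ∈ S' A → m ℤ.≤ u × u ℤ.≤ M
  S'-bounds u∈S' = sumsetL-bounds A (allFin k) (S'⊆S u∈S')

  width : Fin k → ℤ
  width i = maxL (A i) - minL (A i)

  start : Fin k → ℤ
  start = prefixSum m width

  InGap : Fin k → ℤ → Set
  InGap i u = start i ℤ.≤ u × u ℤ.< start i ℤ.+ width i

  outside? : ∀ i u → Dec (¬ InGap i u)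
  outside? i u = ¬? ((start i ℤ.≤? u) ×-dec (u <? start i ℤ.+ width i))

  gaps-cover : ∀ {u} → m ℤ.≤ u → u ℤ.< M → ∃ λ i → InGap i u
  gaps-cover {u} m≤u u<M = prefixSum-cover m width m≤u (subst (u ℤ.<_) M≡m+Σwidth u<M)
    where
      open ≡-Reasoning
      M≡m+Σwidth : M ≡ m ℤ.+ sumℤ (tabulate width)
      M≡m+Σwidth = begin
        M
          ≡⟨ sumℤ-map-+-differences (minL ∘ A) (maxL ∘ A) (allFin k) ⟨
        m ℤ.+ sumℤ (map width (allFin k))
          ≡⟨ cong (λ ws → m ℤ.+ sumℤ ws) (map-tabulate (λ i → i) width) ⟩
        m ℤ.+ sumℤ (tabulate width)
          ∎

  jumpᵢ : Fin k → ℤ → ℤ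
  jumpᵢ i = Jump.jump (minL (A i)) (maxL (A i)) (start i)

  jumpᵢ-∈-S' : ∀ i {x} → x ∈ Sᵢ A i → jumpᵢ i x ∈ S' A
  jumpᵢ-∈-S' i {x} x∈Sᵢ = ∈-concatMap⁺ (S'ᵢ A) (lose (∈-allFin i) jumpᵢx∈S'ᵢ)
    where
      x∈others : x ∈ sumsetL (map (A′ i) (others i))
      x∈others = sumsetL-mono A (A′ i) (others i)
        (λ j∈ → subst (_ ∈_) (sym (A′-off-diag (others-≢ j∈)))) x∈Sᵢ
      x+end∈S'ᵢ : ∀ {a} → a ∈ ends (A i) → x ℤ.+ a ∈ S'ᵢ A i
      x+end∈S'ᵢ a∈ = sumsetL-insert Fin._≟_ (A′ i) (Unique.allFin⁺ k) (∈-allFin i)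
        x∈others (subst (_ ∈_) (sym (A′-diag i)) a∈)
      jumpᵢx∈S'ᵢ : jumpᵢ i x ∈ S'ᵢ A i
      jumpᵢx∈S'ᵢ with Jump.jump-cases (minL (A i)) (maxL (A i)) (start i) x
      ... | inj₁ jx≡x+min = subst (_∈ S'ᵢ A i) (sym jx≡x+min) (x+end∈S'ᵢ (here refl))
      ... | inj₂ jx≡x+max = subst (_∈ S'ᵢ A i) (sym jx≡x+max) (x+end∈S'ᵢ (there (here refl)))

  U : List ℤ
  U = deduplicate ℤ._≟_ (S' A)

  card-Sᵢ≤#row : ∀ i → card (Sᵢ A i) ≤ #row outside? i U
  card-Sᵢ≤#row i = card-≤-filter-image (outside? i) (jumpᵢ i)
    (Jump.jump-injective _ _ _ (minL≤maxL (A≢[] i))) (jumpᵢ-∈-S' i) (Jump.jump-∉-gap _ _ _)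

  #column≤k : ∀ u → #column outside? (allFin k) u ≤ suc (k ∸ 1)
  #column≤k u = ℕ.≤-trans (length-filter (λ i → outside? i u) (allFin k))
    (subst (_≤ suc (k ∸ 1)) (sym (length-tabulate (λ i → i))) (ℕ.m≤n+m∸n k 1))

  #column<k : ∀ {u} → u ∈ U → u ≢ M → #column outside? (allFin k) u ≤ k ∸ 1
  #column<k {u} u∈U u≢M with S'-bounds (∈-deduplicate⁻ ℤ._≟_ (S' A) u∈U)
  ... | m≤u , u≤M with gaps-cover m≤u (ℤ.≤∧≢⇒< u≤M u≢M)
  ... | i , u∈gapᵢ = ℕ.suc[m]≤n⇒m≤pred[n] {n = k}
    (subst (#column outside? (allFin k) u <_) (length-tabulate (λ i → i))
      (filter-notAll (λ i → outside? i u) (allFin k)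
        (lose (∈-allFin i) (λ u∉gapᵢ → u∉gapᵢ u∈gapᵢ))))

theorem1 : (k : ℕ) → 2 ≤ k → (A : Fin k → List ℤ) → (∀ i → A i ≢ []) →
    (card (S' A) ≤ card (S A)) ×
    (sum (map (λ i → card (Sᵢ A i)) (allFin k)) ≤ (k ∸ 1) * card (S' A) + 1)
theorem1 k _ A A≢[] = card-mono S'⊆S , (begin
    sum (map (λ i → card (Sᵢ A i)) (allFin k))
      ≤⟨ sum-map-mono card-Sᵢ≤#row (allFin k) ⟩
    sum (map (λ i → #row outside? i U) (allFin k))
      ≡⟨ sum-#row≡sum-#column outside? (allFin k) U ⟩
    sum (map (#column outside? (allFin k)) U)
      ≤⟨ sum-map-≤-except _ (k ∸ 1) M (UniqueDec.deduplicate-! ℤ._≟_ (S' A)) #column≤k #column<k ⟩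
    (k ∸ 1) * card (S' A) + 1
      ∎)
  where
    open Gaps A A≢[]
    open ℕ.≤-Reasoning
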